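{- Let $k\geq 3$ be odd and let $f\colon\mathbb{F}_2^k\to\mathbb{F}_2$ be \[ f(x_1,\ldots,x_{k})=x_1+x_2+x_{k-1}+x_{k}+\sum_{i=1}^{k-2}x_ix_{i+1}. \] Then $f$ is balanced and its nonlinearity is $N_f=2^{k-1}-2^{\frac{k-1}{2}}$.
   Context: A Boolean function on $\mathbb{F}_2^k$ is balanced if it takes the value $1$ exactly $2^{k-1}$ times. The nonlinearity $N_f$ is the minimum Hamming distance between the truth table of $f$ and the truth tables of all affine functions $\mathbb{F}_2^k\to\mathbb{F}_2$; equivalently $N_f=2^{k-1}-\frac12\max_{u\in\mathbb{F}_2^k}\lvert W_f(u)\rvert$ with $W_f(u)=\sum_{x\in\mathbb{F}_2^k}(-1)^{f(x)+u\cdot x}$. -}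

module Defs where

open import Data.Bool using (Bool; true; false; _xor_; _∧_; if_then_else_)
open import Data.Nat using (ℕ; zero; suc; _+_; _∸_; _^_; _<_; _⊓_; s≤s; z≤n)
open import Data.Nat.Properties using (≤-refl; ≤-trans; n≤1+n)
open import Data.List using (List; []; _∷_; map; _++_; length; filter; foldr; zipWith)
open import Data.Vec using (Vec; []; _∷_; lookup; init)
open import Data.Fin using (Fin; fromℕ<)
open import Data.Product using (_×_; _,_)

-- F₂ is modelled by Bool: addition = xor, multiplication = ∧.

allVecs : (n : ℕ) → List (Vec Bool n)
allVecs zero = [] ∷ []
allVecs (suc n) = map (false ∷_) (allVecs n) ++ map (true ∷_) (allVecs n)

BoolFun : ℕ → Set
BoolFun k = Vec Bool k → Bool

weight : {k : ℕ} → BoolFun k → ℕ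
weight {k} f = length (filter (λ x → f x Data.Bool.≟ true) (allVecs k))
  where import Data.Bool

Balanced : {k : ℕ} → BoolFun k → Set
Balanced {k} f = weight f ≡ 2 ^ (k ∸ 1)
  where open import Relation.Binary.PropositionalEquality using (_≡_)

dot : {k : ℕ} → Vec Bool k → Vec Bool k → Bool
dot [] [] = false
dot (u ∷ us) (x ∷ xs) = (u ∧ x) xor dot us xs

affine : {k : ℕ} → Vec Bool k → Bool → BoolFun k
affine u c x = dot u x xor c

dist : {k : ℕ} → BoolFun k → BoolFun k → ℕ
dist {k} f g = length (filter (λ x → (f x xor g x) Data.Bool.≟ true) (allVecs k))
  where import Data.Bool

allAffineParams : (k : ℕ) → List (Vec Bool k × Bool)
allAffineParams k = map (_, false) (allVecs k) ++ map (_, true) (allVecs k)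

minimumOr : ℕ → List ℕ → ℕ
minimumOr d [] = d
minimumOr d (n ∷ ns) = foldr _⊓_ n ns

-- Nonlinearity: minimum Hamming distance from f to all affine functions
-- (the list of affine functions is never empty; default is irrelevant)
nonlinearity : {k : ℕ} → BoolFun k → ℕ
nonlinearity {k} f =
  minimumOr (2 ^ k) (map (λ { (u , c) → dist f (affine u c) }) (allAffineParams k))

chain : {k : ℕ} → Vec Bool k → Bool
chain [] = false
chain (a ∷ []) = false
chain (a ∷ b ∷ xs) = (a ∧ b) xor chain (b ∷ xs)

-- The function of the theorem, for k ≥ 3 (written k = suc (suc (suc n))):
-- f(x₁,…,x_k) = x₁ + x₂ + x_{k-1} + x_k + Σ_{i=1}^{k-2} x_i x_{i+1}
-- (0-based indices: x₁ = 0, x₂ = 1, x_{k-1} = k-2, x_k = k-1);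
-- Σ_{i=1}^{k-2} x_i x_{i+1} = chain of (x₁,…,x_{k-1}) = chain (init x)
fThm : (n : ℕ) → BoolFun (suc (suc (suc n)))
fThm n x =
  lookup x (fromℕ< {0} (s≤s z≤n)) xor
  lookup x (fromℕ< {1} (s≤s (s≤s z≤n))) xor
  lookup x (fromℕ< {suc n} (s≤s (n≤1+n (suc n)))) xor
  lookup x (fromℕ< {suc (suc n)} ≤-refl) xor
  chain (init x)

-- Write x = (y , x_k) with y ∈ F₂^(k-1). The variable x_k enters f only
-- linearly, f(x) = q(y) + λ(y) + x_k with q(y) = Σ y_i y_(i+1), so f is
-- balanced, and so is f + a for every affine a whose x_k-coefficient is 0.
-- For the other affine a, f + a does not depend on x_k and its distance is
-- twice the weight of q + (an affine function) on F₂^(k-1), k - 1 = 2j + 2.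
-- Summing out y_1, which occurs only in y_1 (y_2 + w_1), shows that such a
-- weight on 2j + 4 variables is 2^(2j+2) + 2 · (such a weight on 2j + 2
-- variables); hence all of them are 2^(2j+1) ± 2^j (q is bent), with the
-- minus sign for q itself. So every distance is at least
-- 2^(k-1) - 2^((k-1)/2), with equality for a = λ + x_k.
module Submission where

open import Defs
open import Data.Nat using (ℕ; suc; _^_; _∸_; _*_; _+_; _/_)
open import Data.Product using (_×_)
open import Relation.Binary.PropositionalEquality using (_≡_)

open import Algebra.Properties.CommutativeSemigroup using (interchange)
open import Data.Bool using (Bool; true; false; not; _∧_; _xor_; _≟_)
open import Data.Bool.Properties using (xor-∧-commutativeRing; xor-identityʳ; xor-comm; xor-assoc; xor-same)
open import Data.Fin as Fin using (Fin; fromℕ<)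
open import Data.List using (List; []; _∷_; map; _++_; length; filter)
open import Data.List.Membership.Propositional using (_∈_)
open import Data.List.Membership.Propositional.Properties using (∈-map⁺; ∈-++⁺ˡ; ∈-++⁺ʳ)
open import Data.List.Properties using (length-++; filter-++; filter-≐; foldr-preservesᵇ; foldr-preservesᵒ)
open import Data.List.Relation.Unary.All using (All; _∷_; tabulate)
open import Data.List.Relation.Unary.All.Properties using (map⁺)
open import Data.List.Relation.Unary.Any as Any using (Any; here; there)
open import Data.Maybe using (just; nothing)
open import Data.Nat using (zero; _≤_; _<_; z≤n; s≤s)
open import Data.Nat.DivMod using (m*n/n≡m)
open import Data.Nat.Properties
  using (+-comm; *-comm; +-identityʳ; *-distribˡ-+; +-commutativeSemigroup; m+n∸n≡m; m∸n≤m; m≤m+n;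
         ≤-refl; ≤-reflexive; ≤-trans; ≤-antisym; ⊓-glb; m≤n⇒m⊓o≤n; m≤n⇒o⊓m≤n; m<n⇒m<1+n)
open import Data.Nat.Tactic.RingSolver using (ring)
open import Data.Product using (_,_)
open import Data.Sum using (_⊎_; inj₁; inj₂; [_,_])
open import Data.Vec using (Vec; []; _∷_; lookup; init; last; head; tail; replicate; zipWith; _∷ʳ_)
open import Data.Vec.Properties using (init-∷ʳ; last-∷ʳ)
open import Function using (_∘_)
open import Relation.Binary.PropositionalEquality
  using (refl; sym; trans; cong; cong₂; subst; _≗_; module ≡-Reasoning)
open import Tactic.RingSolver using (solve-∀)
open import Tactic.RingSolver.Core.AlmostCommutativeRing using (AlmostCommutativeRing; fromCommutativeRing)

xor-∧-ring : AlmostCommutativeRing _ _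
xor-∧-ring = fromCommutativeRing xor-∧-commutativeRing λ { false → just refl ; true → nothing }

private
  count : {A : Set} → (A → Bool) → List A → ℕ
  count h xs = length (filter (λ x → h x ≟ true) xs)

  count-++ : {A : Set} (h : A → Bool) (xs ys : List A) → count h (xs ++ ys) ≡ count h xs + count h ys
  count-++ h xs ys =
    trans (cong length (filter-++ (λ x → h x ≟ true) xs ys)) (length-++ (filter (λ x → h x ≟ true) xs))

  count-map : {A B : Set} (h : B → Bool) (f : A → B) (xs : List A) → count h (map f xs) ≡ count (h ∘ f) xs
  count-map h f [] = refl
  count-map h f (x ∷ xs) with h (f x)
  ... | true  = cong suc (count-map h f xs)
  ... | false = count-map h f xs

weight-∷ : ∀ {n} (g : BoolFun (suc n)) → weight g ≡ weight (g ∘ (false ∷_)) + weight (g ∘ (true ∷_))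
weight-∷ {n} g = trans (count-++ g (map (false ∷_) (allVecs n)) (map (true ∷_) (allVecs n)))
                       (cong₂ _+_ (count-map g (false ∷_) (allVecs n)) (count-map g (true ∷_) (allVecs n)))

weight-cong : ∀ {n} {g h : BoolFun n} → g ≗ h → weight g ≡ weight h
weight-cong {n} g≗h =
  cong length (filter-≐ _ _ ((λ {x} p → trans (sym (g≗h x)) p) , (λ {x} p → trans (g≗h x) p)) (allVecs n))

2^n+2^n≡2^1+n : ∀ n → 2 ^ n + 2 ^ n ≡ 2 ^ suc n
2^n+2^n≡2^1+n n = cong (2 ^ n +_) (sym (+-identityʳ (2 ^ n)))

weight-not : ∀ {n} (g : BoolFun n) → weight g + weight (not ∘ g) ≡ 2 ^ n
weight-not {zero} g with g []
... | true  = refl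
... | false = refl
weight-not {suc n} g = begin
  weight g + weight (not ∘ g)
    ≡⟨ cong₂ _+_ (weight-∷ g) (weight-∷ (not ∘ g)) ⟩
  (weight g₀ + weight g₁) + (weight (not ∘ g₀) + weight (not ∘ g₁))
    ≡⟨ interchange +-commutativeSemigroup (weight g₀) (weight g₁) _ _ ⟩
  (weight g₀ + weight (not ∘ g₀)) + (weight g₁ + weight (not ∘ g₁))
    ≡⟨ cong₂ _+_ (weight-not g₀) (weight-not g₁) ⟩
  2 ^ n + 2 ^ n
    ≡⟨ 2^n+2^n≡2^1+n n ⟩
  2 ^ suc n ∎
  where
  open ≡-Reasoning
  g₀ g₁ : BoolFun n
  g₀ = g ∘ (false ∷_)
  g₁ = g ∘ (true ∷_)

weight-init : ∀ {n} (h : BoolFun n) → weight {suc n} (h ∘ init) ≡ 2 * weight h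
weight-init {zero} h =
  trans (weight-∷ (h ∘ init))
        (cong₂ _+_ (weight-cong {g = λ x → h (init (false ∷ x))} {h = h} λ { [] → refl })
                   (trans (weight-cong {g = λ x → h (init (true ∷ x))} {h = h} λ { [] → refl })
                          (sym (+-identityʳ (weight h)))))
weight-init {suc n} h = begin
  weight (h ∘ init)
    ≡⟨ weight-∷ (h ∘ init) ⟩
  weight (h₀ ∘ init) + weight (h₁ ∘ init)
    ≡⟨ cong₂ _+_ (weight-init h₀) (weight-init h₁) ⟩
  2 * weight h₀ + 2 * weight h₁
    ≡⟨ sym (*-distribˡ-+ 2 (weight h₀) (weight h₁)) ⟩
  2 * (weight h₀ + weight h₁)
    ≡⟨ cong (2 *_) (sym (weight-∷ h)) ⟩
  2 * weight h ∎
  where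
  open ≡-Reasoning
  h₀ h₁ : BoolFun n
  h₀ = h ∘ (false ∷_)
  h₁ = h ∘ (true ∷_)

weight-init-xor-last : ∀ {n} (h : BoolFun n) → weight {suc n} (λ x → h (init x) xor last x) ≡ 2 ^ n
weight-init-xor-last {zero} h =
  trans (weight-∷ {0} (λ x → h (init x) xor last x))
        (trans (cong₂ _+_ (weight-cong {g = λ x → h (init (false ∷ x)) xor last (false ∷ x)} {h = h}
                                       λ { [] → xor-identityʳ (h []) })
                          (weight-cong {g = λ x → h (init (true ∷ x)) xor last (true ∷ x)} {h = not ∘ h}
                                       λ { [] → xor-comm (h []) true }))
               (weight-not h))
weight-init-xor-last {suc n} h =
  trans (weight-∷ {suc n} (λ x → h (init x) xor last x))
        (trans (cong₂ _+_ (weight-init-xor-last (h ∘ (false ∷_))) (weight-init-xor-last (h ∘ (true ∷_))))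
               (2^n+2^n≡2^1+n n))

-- Summing over a first: for b ≠ t the term a ∧ (b xor t) makes the sum over a
-- balanced, so only the slice b = t survives, twice.
weight-hyperbolic-pair : ∀ {n} (t : Bool) (p : Bool → BoolFun n) →
  weight {suc (suc n)} (λ x → (head x ∧ (head (tail x) xor t)) xor p (head (tail x)) (tail (tail x)))
    ≡ 2 ^ n + 2 * weight (p t)
weight-hyperbolic-pair {n} t p = begin
  weight g
    ≡⟨ weight-∷ g ⟩
  weight (g ∘ (false ∷_)) + weight (g ∘ (true ∷_))
    ≡⟨ cong₂ _+_ (weight-∷ (g ∘ (false ∷_))) (weight-∷ (g ∘ (true ∷_))) ⟩
  (weight (p false) + weight (p true)) + (weight (λ x → t xor p false x) + weight (λ x → not t xor p true x))
    ≡⟨ sum-of-slices t ⟩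
  2 ^ n + 2 * weight (p t) ∎
  where
  open ≡-Reasoning
  g : BoolFun (suc (suc n))
  g x = (head x ∧ (head (tail x) xor t)) xor p (head (tail x)) (tail (tail x))
  sum-of-slices : ∀ s →
    (weight (p false) + weight (p true)) + (weight (λ x → s xor p false x) + weight (λ x → not s xor p true x))
      ≡ 2 ^ n + 2 * weight (p s)
  sum-of-slices false =
    trans (rearrange (weight (p false)) (weight (p true)) (weight (not ∘ p true)))
          (cong (_+ 2 * weight (p false)) (weight-not (p true)))
    where
    rearrange : ∀ a b c → (a + b) + (a + c) ≡ (b + c) + 2 * a
    rearrange = solve-∀ ring
  sum-of-slices true =
    trans (rearrange (weight (p false)) (weight (p true)) (weight (not ∘ p false)))
          (cong (_+ 2 * weight (p true)) (weight-not (p false)))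
    where
    rearrange : ∀ a b c → (a + b) + (c + b) ≡ (a + c) + 2 * b
    rearrange = solve-∀ ring

infixr 5 _⊕_

_⊕_ : ∀ {n} → Vec Bool n → Vec Bool n → Vec Bool n
_⊕_ = zipWith _xor_

⊕-self : ∀ {n} (v : Vec Bool n) → v ⊕ v ≡ replicate n false
⊕-self []      = refl
⊕-self (a ∷ v) = cong₂ _∷_ (xor-same a) (⊕-self v)

dot-⊕ : ∀ {n} (u v x : Vec Bool n) → dot (u ⊕ v) x ≡ dot u x xor dot v x
dot-⊕ []      []      []      = refl
dot-⊕ (a ∷ u) (b ∷ v) (y ∷ x) =
  trans (cong (((a xor b) ∧ y) xor_) (dot-⊕ u v x)) (distrib a b y (dot u x) (dot v x))
  where
  distrib : ∀ a b y p q → ((a xor b) ∧ y) xor (p xor q) ≡ ((a ∧ y) xor p) xor ((b ∧ y) xor q)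
  distrib = solve-∀ xor-∧-ring

dot-replicate-false : ∀ {n} (x : Vec Bool n) → dot (replicate n false) x ≡ false
dot-replicate-false []      = refl
dot-replicate-false (_ ∷ x) = dot-replicate-false x

dot-init-last : ∀ {n} (w x : Vec Bool (suc n)) → dot w x ≡ dot (init w) (init x) xor (last w ∧ last x)
dot-init-last {zero}  (a ∷ []) (y ∷ []) = xor-identityʳ (a ∧ y)
dot-init-last {suc n} (a ∷ w)  (y ∷ x)  =
  trans (cong ((a ∧ y) xor_) (dot-init-last w x))
        (sym (xor-assoc (a ∧ y) (dot (init w) (init x)) (last w ∧ last x)))

unit : ∀ {n} → Fin n → Vec Bool n
unit {suc n} Fin.zero    = true ∷ replicate n false
unit         (Fin.suc i) = false ∷ unit i

dot-unit : ∀ {n} (i : Fin n) (x : Vec Bool n) → dot (unit i) x ≡ lookup x i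
dot-unit Fin.zero    (y ∷ x) = trans (cong (y xor_) (dot-replicate-false x)) (xor-identityʳ y)
dot-unit (Fin.suc i) (_ ∷ x) = dot-unit i x

lookup-fromℕ<-last : ∀ {A : Set} {n} (x : Vec A (suc n)) → lookup x (fromℕ< ≤-refl) ≡ last x
lookup-fromℕ<-last {n = zero}  (a ∷ []) = refl
lookup-fromℕ<-last {n = suc n} (a ∷ x)  = lookup-fromℕ<-last x

lookup-fromℕ<-init : ∀ {A : Set} {j n} (x : Vec A (suc n)) (j<n : j < n) →
  lookup x (fromℕ< (m<n⇒m<1+n j<n)) ≡ lookup (init x) (fromℕ< j<n)
lookup-fromℕ<-init {j = zero}  {suc n} (a ∷ x) _         = refl
lookup-fromℕ<-init {j = suc j} {suc n} (a ∷ x) (s≤s j<n) = lookup-fromℕ<-init x j<n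

minimumOr-attained : ∀ {d b} xs → b ∈ xs → All (b ≤_) xs → minimumOr d xs ≡ b
minimumOr-attained {b = b} (x ∷ xs) b∈x∷xs (b≤x ∷ b≤xs) = ≤-antisym
  (foldr-preservesᵒ {P = _≤ b} (λ y z → [ m≤n⇒m⊓o≤n z , m≤n⇒o⊓m≤n y ]) x xs (some-≤ b∈x∷xs))
  (foldr-preservesᵇ {P = b ≤_} ⊓-glb b≤x b≤xs)
  where
  some-≤ : b ∈ x ∷ xs → x ≤ b ⊎ Any (_≤ b) xs
  some-≤ (here b≡x)   = inj₁ (≤-reflexive (sym b≡x))
  some-≤ (there b∈xs) = inj₂ (Any.map (λ b≡y → ≤-reflexive (sym b≡y)) b∈xs)

minimumOr-map-attained : ∀ {A : Set} {d b} (g : A → ℕ) (xs : List A) (x₀ : A) →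
  x₀ ∈ xs → g x₀ ≡ b → (∀ x → b ≤ g x) → minimumOr d (map g xs) ≡ b
minimumOr-map-attained g xs x₀ x₀∈xs refl lower =
  minimumOr-attained (map g xs) (∈-map⁺ g x₀∈xs) (map⁺ (tabulate λ {x} _ → lower x))

∈-allVecs : ∀ {n} (v : Vec Bool n) → v ∈ allVecs n
∈-allVecs []                 = here refl
∈-allVecs (false ∷ v)        = ∈-++⁺ˡ (∈-map⁺ (false ∷_) (∈-allVecs v))
∈-allVecs {suc n} (true ∷ v) = ∈-++⁺ʳ (map (false ∷_) (allVecs n)) (∈-map⁺ (true ∷_) (∈-allVecs v))

∈-allAffineParams : ∀ {k} (p : Vec Bool k × Bool) → p ∈ allAffineParams k
∈-allAffineParams (u , false)     = ∈-++⁺ˡ (∈-map⁺ (_, false) (∈-allVecs u))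
∈-allAffineParams {k} (u , true) = ∈-++⁺ʳ (map (_, false) (allVecs k)) (∈-map⁺ (_, true) (∈-allVecs u))

nonlinearity-attained : ∀ {k b} (f : BoolFun k) (u₀ : Vec Bool k) (c₀ : Bool) →
  dist f (affine u₀ c₀) ≡ b → (∀ u c → b ≤ dist f (affine u c)) → nonlinearity f ≡ b
nonlinearity-attained {k} f u₀ c₀ attained lower =
  minimumOr-map-attained _ (allAffineParams k) (u₀ , c₀) (∈-allAffineParams (u₀ , c₀)) attained
                         (λ (u , c) → lower u c)

infix 4 _≡_±_

data _≡_±_ (w t d : ℕ) : Set where
  minus : w + d ≡ t → w ≡ t ± d
  plus  : w ≡ t + d → w ≡ t ± d

±-lower : ∀ {w t d} → w ≡ t ± d → t ∸ d ≤ w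
±-lower {w} {d = d} (minus refl) = ≤-reflexive (m+n∸n≡m w d)
±-lower {t = t} {d} (plus refl)  = ≤-trans (m∸n≤m t d) (m≤m+n t d)

±-double : ∀ {w t d} → w ≡ t ± d → 2 * w ≡ 2 * t ± 2 * d
±-double {w} {d = d} (minus refl) = minus (sym (*-distribˡ-+ 2 w d))
±-double {t = t} {d} (plus refl)  = plus (*-distribˡ-+ 2 t d)

minus-step : ∀ {w t d} → w + d ≡ t → (2 * t + 2 * w) + 2 * d ≡ 2 * (2 * t)
minus-step {w} {d = d} refl = identity w d
  where
  identity : ∀ w d → (2 * (w + d) + 2 * w) + 2 * d ≡ 2 * (2 * (w + d))
  identity = solve-∀ ring

±-step : ∀ {w t d} → w ≡ t ± d → 2 * t + 2 * w ≡ 2 * (2 * t) ± 2 * d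
±-step {w} {d = d} (minus e)      = minus (minus-step {w} {d = d} e)
±-step {t = t} {d} (plus refl)    = plus (identity t d)
  where
  identity : ∀ t d → 2 * t + 2 * (t + d) ≡ 2 * (2 * t) + 2 * d
  identity = solve-∀ ring

chain⊕affine : ∀ {n} → Vec Bool n → Bool → BoolFun n
chain⊕affine w c x = chain x xor affine w c x

weight-chain⊕affine-∷∷ : ∀ {n} (w₁ w₂ w₃ : Bool) (ws : Vec Bool n) (c : Bool) →
  weight (chain⊕affine (w₁ ∷ w₂ ∷ w₃ ∷ ws) c)
    ≡ 2 ^ suc n + 2 * weight (chain⊕affine ((w₃ xor w₁) ∷ ws) (c xor (w₁ ∧ w₂)))
weight-chain⊕affine-∷∷ {n} w₁ w₂ w₃ ws c = begin
  weight (chain⊕affine (w₁ ∷ w₂ ∷ w₃ ∷ ws) c)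
    ≡⟨ weight-cong split ⟩
  weight (λ x → (head x ∧ (head (tail x) xor w₁)) xor slice (head (tail x)) (tail (tail x)))
    ≡⟨ weight-hyperbolic-pair w₁ slice ⟩
  2 ^ suc n + 2 * weight (slice w₁)
    ≡⟨ cong (λ W → 2 ^ suc n + 2 * W) (weight-cong shift) ⟩
  2 ^ suc n + 2 * weight (chain⊕affine ((w₃ xor w₁) ∷ ws) (c xor (w₁ ∧ w₂))) ∎
  where
  open ≡-Reasoning
  slice : Bool → BoolFun (suc n)
  slice b x = chain (b ∷ x) xor (((w₂ ∧ b) xor dot (w₃ ∷ ws) x) xor c)
  split-identity : ∀ a b t q r c →
    ((a ∧ b) xor q) xor (((t ∧ a) xor r) xor c) ≡ (a ∧ (b xor t)) xor (q xor (r xor c))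
  split-identity = solve-∀ xor-∧-ring
  split : ∀ x → chain⊕affine (w₁ ∷ w₂ ∷ w₃ ∷ ws) c x
              ≡ (head x ∧ (head (tail x) xor w₁)) xor slice (head (tail x)) (tail (tail x))
  split (a ∷ b ∷ x) = split-identity a b w₁ (chain (b ∷ x)) ((w₂ ∧ b) xor dot (w₃ ∷ ws) x) c
  shift-identity : ∀ s₁ s₂ s₃ y q d c →
    ((s₁ ∧ y) xor q) xor (((s₂ ∧ s₁) xor ((s₃ ∧ y) xor d)) xor c)
      ≡ q xor ((((s₃ xor s₁) ∧ y) xor d) xor (c xor (s₁ ∧ s₂)))
  shift-identity = solve-∀ xor-∧-ring
  shift : slice w₁ ≗ chain⊕affine ((w₃ xor w₁) ∷ ws) (c xor (w₁ ∧ w₂))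
  shift (y ∷ ys) = shift-identity w₁ w₂ w₃ y (chain (y ∷ ys)) (dot ws ys) c

weight-chain⊕affine : ∀ m (w : Vec Bool (2 + m * 2)) (c : Bool) →
  weight (chain⊕affine w c) ≡ 2 ^ (1 + m * 2) ± 2 ^ m
weight-chain⊕affine zero (false ∷ false ∷ []) false = minus refl
weight-chain⊕affine zero (false ∷ false ∷ []) true  = plus refl
weight-chain⊕affine zero (false ∷ true  ∷ []) false = minus refl
weight-chain⊕affine zero (false ∷ true  ∷ []) true  = plus refl
weight-chain⊕affine zero (true  ∷ false ∷ []) false = minus refl
weight-chain⊕affine zero (true  ∷ false ∷ []) true  = plus refl
weight-chain⊕affine zero (true  ∷ true  ∷ []) false = plus refl
weight-chain⊕affine zero (true  ∷ true  ∷ []) true  = minus refl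
weight-chain⊕affine (suc m) (w₁ ∷ w₂ ∷ w₃ ∷ ws) c =
  subst (_≡ _ ± _) (sym (weight-chain⊕affine-∷∷ w₁ w₂ w₃ ws c))
        (±-step (weight-chain⊕affine m ((w₃ xor w₁) ∷ ws) (c xor (w₁ ∧ w₂))))

weight-chain⊕affine-zero : ∀ m →
  weight (chain⊕affine (replicate (2 + m * 2) false) false) + 2 ^ m ≡ 2 ^ (1 + m * 2)
weight-chain⊕affine-zero zero    = refl
weight-chain⊕affine-zero (suc m) =
  trans (cong (_+ 2 ^ suc m) (weight-chain⊕affine-∷∷ false false false (replicate (1 + m * 2) false) false))
        (minus-step {d = 2 ^ m} (weight-chain⊕affine-zero m))

fLinear : ∀ n → Vec Bool (suc (suc n))
fLinear n = unit (fromℕ< {0} (s≤s z≤n)) ⊕ unit (fromℕ< {1} (s≤s (s≤s z≤n))) ⊕ unit (fromℕ< {suc n} ≤-refl)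

fThm-init-last : ∀ n x → fThm n x ≡ chain⊕affine (fLinear n) false (init x) xor last x
fThm-init-last n x = begin
  fThm n x
    ≡⟨ regroup (lookup x i₀) (lookup x i₁) (lookup x i₂) (lookup x i₃) (chain y) ⟩
  (chain y xor ((lookup x i₀ xor (lookup x i₁ xor lookup x i₂)) xor false)) xor lookup x i₃
    ≡⟨ cong₂ (λ d l → (chain y xor (d xor false)) xor l) linear (lookup-fromℕ<-last x) ⟩
  chain⊕affine (fLinear n) false y xor last x ∎
  where
  open ≡-Reasoning
  y : Vec Bool (suc (suc n))
  y = init x
  i₀ i₁ i₂ i₃ : Fin (suc (suc (suc n)))
  i₀ = fromℕ< {0} (s≤s z≤n)
  i₁ = fromℕ< {1} (s≤s (s≤s z≤n))
  i₂ = fromℕ< {suc n} (s≤s (m<n⇒m<1+n ≤-refl))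
  i₃ = fromℕ< ≤-refl
  j₀ j₁ j₂ : Fin (suc (suc n))
  j₀ = fromℕ< {0} (s≤s z≤n)
  j₁ = fromℕ< {1} (s≤s (s≤s z≤n))
  j₂ = fromℕ< {suc n} ≤-refl
  regroup : ∀ l₀ l₁ l₂ l₃ q →
    l₀ xor (l₁ xor (l₂ xor (l₃ xor q))) ≡ (q xor ((l₀ xor (l₁ xor l₂)) xor false)) xor l₃
  regroup = solve-∀ xor-∧-ring
  linear : lookup x i₀ xor (lookup x i₁ xor lookup x i₂) ≡ dot (fLinear n) y
  linear = sym (begin
    dot (fLinear n) y
      ≡⟨ dot-⊕ (unit j₀) (unit j₁ ⊕ unit j₂) y ⟩
    dot (unit j₀) y xor dot (unit j₁ ⊕ unit j₂) y
      ≡⟨ cong (dot (unit j₀) y xor_) (dot-⊕ (unit j₁) (unit j₂) y) ⟩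
    dot (unit j₀) y xor (dot (unit j₁) y xor dot (unit j₂) y)
      ≡⟨ cong₂ _xor_ (dot-unit j₀ y) (cong₂ _xor_ (dot-unit j₁ y) (dot-unit j₂ y)) ⟩
    lookup y j₀ xor (lookup y j₁ xor lookup y j₂)
      ≡⟨ sym (cong₂ _xor_ (lookup-fromℕ<-init x (s≤s z≤n))
                          (cong₂ _xor_ (lookup-fromℕ<-init x (s≤s (s≤s z≤n))) (lookup-fromℕ<-init x ≤-refl))) ⟩
    lookup x i₀ xor (lookup x i₁ xor lookup x i₂) ∎)

fThm-balanced : ∀ n → Balanced (fThm n)
fThm-balanced n = trans (weight-cong (fThm-init-last n)) (weight-init-xor-last (chain⊕affine (fLinear n) false))

fThm-xor-affine : ∀ n u c x →
  fThm n x xor affine u c x ≡ chain⊕affine (fLinear n ⊕ init u) c (init x) xor ((true xor last u) ∧ last x)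
fThm-xor-affine n u c x = begin
  fThm n x xor affine u c x
    ≡⟨ cong₂ (λ f d → f xor (d xor c)) (fThm-init-last n x) (dot-init-last u x) ⟩
  ((chain y xor (dot L y xor false)) xor last x) xor ((dot (init u) y xor (last u ∧ last x)) xor c)
    ≡⟨ regroup (chain y) (dot L y) (dot (init u) y) (last u) (last x) c ⟩
  (chain y xor ((dot L y xor dot (init u) y) xor c)) xor ((true xor last u) ∧ last x)
    ≡⟨ cong (λ d → (chain y xor (d xor c)) xor ((true xor last u) ∧ last x)) (sym (dot-⊕ L (init u) y)) ⟩
  chain⊕affine (L ⊕ init u) c y xor ((true xor last u) ∧ last x) ∎
  where
  open ≡-Reasoning
  L y : Vec Bool (suc (suc n))
  L = fLinear n
  y = init x
  regroup : ∀ q d e t l c → ((q xor (d xor false)) xor l) xor ((e xor (t ∧ l)) xor c)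
                            ≡ (q xor ((d xor e) xor c)) xor ((true xor t) ∧ l)
  regroup = solve-∀ xor-∧-ring

dist-fThm-affine : ∀ n u c →
  dist (fThm n) (affine u c)
    ≡ weight (λ x → chain⊕affine (fLinear n ⊕ init u) c (init x) xor ((true xor last u) ∧ last x))
dist-fThm-affine n u c = weight-cong (fThm-xor-affine n u c)

dist-fThm-affine-lower : ∀ m u c → 2 ^ (2 + m * 2) ∸ 2 ^ suc m ≤ dist (fThm (m * 2)) (affine u c)
dist-fThm-affine-lower m u c =
  subst (_ ≤_) (sym (dist-fThm-affine (m * 2) u c)) (by-last-coefficient (last u))
  where
  h : BoolFun (2 + m * 2)
  h = chain⊕affine (fLinear (m * 2) ⊕ init u) c
  by-last-coefficient : ∀ t →
    2 ^ (2 + m * 2) ∸ 2 ^ suc m ≤ weight (λ x → h (init x) xor ((true xor t) ∧ last x))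
  by-last-coefficient false =
    ≤-trans (m∸n≤m (2 ^ (2 + m * 2)) (2 ^ suc m)) (≤-reflexive (sym (weight-init-xor-last h)))
  by-last-coefficient true  =
    ≤-trans (±-lower (±-double (weight-chain⊕affine m (fLinear (m * 2) ⊕ init u) c)))
            (≤-reflexive (sym (trans (weight-cong (λ x → xor-identityʳ (h (init x)))) (weight-init h))))

dist-fThm-affine-fLinear : ∀ m →
  dist (fThm (m * 2)) (affine (fLinear (m * 2) ∷ʳ true) false) ≡ 2 ^ (2 + m * 2) ∸ 2 ^ suc m
dist-fThm-affine-fLinear m = begin
  dist (fThm (m * 2)) (affine u₀ false)
    ≡⟨ dist-fThm-affine (m * 2) u₀ false ⟩
  weight (λ x → chain⊕affine (L ⊕ init u₀) false (init x) xor ((true xor last u₀) ∧ last x))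
    ≡⟨ weight-cong (λ x → cong₂ (λ w t → chain⊕affine w false (init x) xor ((true xor t) ∧ last x))
                                (trans (cong (L ⊕_) (init-∷ʳ true L)) (⊕-self L)) (last-∷ʳ true L)) ⟩
  weight (λ x → q (init x) xor false)
    ≡⟨ weight-cong (λ x → xor-identityʳ (q (init x))) ⟩
  weight (q ∘ init)
    ≡⟨ weight-init q ⟩
  2 * weight q
    ≡⟨ sym (m+n∸n≡m (2 * weight q) (2 ^ suc m)) ⟩
  2 * weight q + 2 ^ suc m ∸ 2 ^ suc m
    ≡⟨ cong (_∸ 2 ^ suc m) (trans (sym (*-distribˡ-+ 2 (weight q) (2 ^ m)))
                                  (cong (2 *_) (weight-chain⊕affine-zero m))) ⟩
  2 ^ (2 + m * 2) ∸ 2 ^ suc m ∎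
  where
  open ≡-Reasoning
  L : Vec Bool (2 + m * 2)
  L = fLinear (m * 2)
  u₀ : Vec Bool (3 + m * 2)
  u₀ = L ∷ʳ true
  q : BoolFun (2 + m * 2)
  q = chain⊕affine (replicate (2 + m * 2) false) false

fThm-nonlinearity : ∀ m → nonlinearity (fThm (m * 2)) ≡ 2 ^ (2 + m * 2) ∸ 2 ^ suc m
fThm-nonlinearity m =
  nonlinearity-attained (fThm (m * 2)) (fLinear (m * 2) ∷ʳ true) false
                        (dist-fThm-affine-fLinear m) (dist-fThm-affine-lower m)

mainTheorem5 : (m : ℕ) →
    let k = 2 * m + 3 in
    Balanced (fThm (2 * m)) ×
    nonlinearity (fThm (2 * m)) ≡ 2 ^ (k ∸ 1) ∸ 2 ^ ((k ∸ 1) / 2)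
mainTheorem5 m = fThm-balanced (2 * m) , (begin
  nonlinearity (fThm (2 * m))
    ≡⟨ cong (nonlinearity ∘ fThm) (*-comm 2 m) ⟩
  nonlinearity (fThm (m * 2))
    ≡⟨ fThm-nonlinearity m ⟩
  2 ^ (suc m * 2) ∸ 2 ^ suc m
    ≡⟨ cong₂ (λ a b → 2 ^ a ∸ 2 ^ b) (sym k∸1≡) (sym (trans (cong (_/ 2) k∸1≡) (m*n/n≡m (suc m) 2))) ⟩
  2 ^ (2 * m + 3 ∸ 1) ∸ 2 ^ ((2 * m + 3 ∸ 1) / 2) ∎)
  where
  open ≡-Reasoning
  k∸1≡ : 2 * m + 3 ∸ 1 ≡ suc m * 2
  k∸1≡ = cong (_∸ 1) (trans (+-comm (2 * m) 3) (cong (3 +_) (*-comm 2 m)))
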